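{- Let $G$ be a finite simple connected graph with $c_{\infty}(G)=1$. Then $G$ does not have a hallway.
   Context: Game with an unbounded-speed robber: on a graph $G$, a set of cops first choose vertices (several cops may share a vertex), then the robber, knowing their positions, chooses a vertex. Then the cops and the robber move alternately, cops first. In the cops' turn, each cop moves to an adjacent vertex or stays. In the robber's turn, she may move along any path of $G$ starting at her current vertex that contains no vertex currently occupied by a cop, or stay. The cops win if at some point a cop occupies the robber's vertex. $c_{\infty}(G)$ is the minimum number of cops that guarantees a cop win. A block of a connected graph $G$ is either a maximal 2-connected subgraph, or an edge not contained in any 2-connected subgraph. The block tree $B(G)$ is the bipartite graph whose vertices are the blocks of $G$ and the cut vertices of $G$, a block $B$ and a cut vertex $v$ being adjacent iff $v\in V(B)$; it is a tree. If $u$ is a cut vertex of $G$ and $B$ a block containing $u$ such that $\{u\}$ is not a dominating set of $B$ (i.e. some vertex of $B$ is neither $u$ nor adjacent to $u$), then $(B,u)$ is called a directed hole. For two distinct blocks $B,B'$ with unique $(B,B')$-path $B\,u_1\dots u_k\,B'$ in $B(G)$, the pair $\{B,B'\}$ is a hallway if both $(B,u_1)$ and $(B',u_k)$ are directed holes. -}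

module Defs where

open import Data.Nat using (ℕ; zero; suc; _<_)
open import Data.Fin using (Fin; zero; suc; inject₁; fromℕ)
open import Data.Bool using (Bool; true; false)
open import Data.List using (List; []; _∷_)
open import Data.Product using (Σ; ∃; ∃-syntax; _×_; _,_)
open import Data.Sum using (_⊎_)
open import Data.Unit using (⊤)
open import Data.Empty using (⊥)
open import Relation.Nullary using (¬_)
open import Relation.Binary.PropositionalEquality using (_≡_; _≢_)
open import Function.Bundles using (_⇔_)

record SimpleGraph (n : ℕ) : Set₁ where
  field
    Adj    : Fin n → Fin n → Set
    sym    : ∀ {u v} → Adj u v → Adj v u
    irrefl : ∀ {u} → ¬ Adj u u
open SimpleGraph public

data Walk {n : ℕ} (E : Fin n → Fin n → Set) (ok : Fin n → Set)
          : Fin n → Fin n → Set where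
  here : ∀ {u} → ok u → Walk E ok u u
  step : ∀ {u w v} → ok u → E u w → Walk E ok w v → Walk E ok u v

Connected : {n : ℕ} → SimpleGraph n → Set
Connected {n} G = (0 < n) × (∀ u v → Walk (Adj G) (λ _ → ⊤) u v)

record Subgraph {n : ℕ} (G : SimpleGraph n) : Set where
  field
    vtx    : Fin n → Bool
    edg    : Fin n → Fin n → Bool
    edgAdj : ∀ {u v} → edg u v ≡ true → Adj G u v
    edgL   : ∀ {u v} → edg u v ≡ true → vtx u ≡ true
    edgR   : ∀ {u v} → edg u v ≡ true → vtx v ≡ true
    edgSym : ∀ u v → edg u v ≡ edg v u
open Subgraph public

module _ {n : ℕ} {G : SimpleGraph n} where

  InV : Subgraph G → Fin n → Set
  InV H v = vtx H v ≡ true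

  InE : Subgraph G → Fin n → Fin n → Set
  InE H u v = edg H u v ≡ true

  _⊆G_ : Subgraph G → Subgraph G → Set
  H ⊆G H' = (∀ v → InV H v → InV H' v) × (∀ u v → InE H u v → InE H' u v)

  SameSub : Subgraph G → Subgraph G → Set
  SameSub H H' = (∀ v → vtx H v ≡ vtx H' v) × (∀ u v → edg H u v ≡ edg H' u v)

  TwoConnected : Subgraph G → Set
  TwoConnected H =
    (∃[ a ] ∃[ b ] ∃[ c ] (InV H a × InV H b × InV H c × a ≢ b × b ≢ c × a ≢ c))
    × (∀ u v → InV H u → InV H v → Walk (InE H) (InV H) u v)
    × (∀ x u v → InV H u → InV H v → u ≢ x → v ≢ x →
         Walk (InE H) (λ w → InV H w × w ≢ x) u v)

  IsBlock : Subgraph G → Set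
  IsBlock B =
    (TwoConnected B × (∀ H → TwoConnected H → B ⊆G H → H ⊆G B))
    ⊎ (∃[ u ] ∃[ v ] (Adj G u v
         × (∀ w → InV B w ⇔ (w ≡ u ⊎ w ≡ v))
         × (∀ a b → InE B a b ⇔ ((a ≡ u × b ≡ v) ⊎ (a ≡ v × b ≡ u)))
         × (∀ H → TwoConnected H → ¬ InE H u v)))

  IsCutVertex : Fin n → Set
  IsCutVertex v = ∃[ a ] ∃[ b ] (a ≢ v × b ≢ v
                    × ¬ Walk (Adj G) (λ w → w ≢ v) a b)

  DirectedHole : Subgraph G → Fin n → Set
  DirectedHole B u = IsCutVertex u × IsBlock B × InV B u
    × ∃[ w ] (InV B w × w ≢ u × ¬ InE B u w)

  -- G has a hallway: there are blocks B = B₀, B₁, …, B_k = B' and cut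
  -- vertices u₁, …, u_k (k = suc m ≥ 1) forming a path
  -- B₀ u₁ B₁ u₂ … u_k B_k in the block tree B(G) (all entries pairwise
  -- distinct, u_i ∈ B_{i-1} ∩ B_i), with (B₀ , u₁) and (B_k , u_k)
  -- directed holes.  (Since B(G) is a tree, this path is the unique
  -- (B,B')-path, and B ≠ B' by distinctness.)
  HasHallway : Set
  HasHallway =
    ∃[ m ] Σ (Fin (suc (suc m)) → Subgraph G) λ Bs →
      Σ (Fin (suc m) → Fin n) λ us →
          (∀ i → IsBlock (Bs i))
        × (∀ i → IsCutVertex (us i))
        × (∀ i → InV (Bs (inject₁ i)) (us i) × InV (Bs (suc i)) (us i))
        × (∀ i j → i ≢ j → ¬ SameSub (Bs i) (Bs j))
        × (∀ i j → i ≢ j → us i ≢ us j)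
        × DirectedHole (Bs zero) (us zero)
        × DirectedHole (Bs (fromℕ (suc m))) (us (fromℕ m))

module Game {n : ℕ} (G : SimpleGraph n) (k : ℕ) where

  Config : Set
  Config = Fin k → Fin n

  CopMove : Config → Config → Set
  CopMove c c' = ∀ i → c' i ≡ c i ⊎ Adj G (c i) (c' i)

  RobberMove : Config → Fin n → Fin n → Set
  RobberMove c r r' = Walk (Adj G) (λ w → ∀ i → c i ≢ w) r r'

  -- history: newest state first
  History : Set
  History = List (Config × Fin n)

  record CopStrategy : Set where
    field
      start : Config
      next  : History → Config
  open CopStrategy public

  LegalCop : CopStrategy → Set
  LegalCop σ = ∀ c r h → CopMove c (next σ ((c , r) ∷ h))

  hist : (ℕ → Config) → (ℕ → Fin n) → ℕ → History
  hist c r zero    = (c zero , r zero) ∷ []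
  hist c r (suc t) = (c (suc t) , r (suc t)) ∷ hist c r t

  -- Play: cops place at c 0, robber places at r 0; in round t the cops
  -- move from c t to c (suc t), then the robber from r t to r (suc t).
  Consistent : CopStrategy → (ℕ → Config) → (ℕ → Fin n) → Set
  Consistent σ c r = (c zero ≡ start σ) × (∀ t → c (suc t) ≡ next σ (hist c r t))

  RobberLegal : (ℕ → Config) → (ℕ → Fin n) → Set
  RobberLegal c r = ∀ t → RobberMove (c (suc t)) (r t) (r (suc t))

  Captured : (ℕ → Config) → (ℕ → Fin n) → Set
  Captured c r = ∃[ t ] ∃[ i ] (c t i ≡ r t ⊎ c (suc t) i ≡ r t)

  CopsWin : Set
  CopsWin = Σ CopStrategy λ σ → LegalCop σ ×
    (∀ c r → Consistent σ c r → RobberLegal c r → Captured c r)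

CInftyIs1 : {n : ℕ} → SimpleGraph n → Set
CInftyIs1 G = Game.CopsWin G 1 × ¬ Game.CopsWin G 0

-- Let (B, u) and (B′, u′) be the directed holes at the two ends of a hallway, and w ∈ B, w′ ∈ B′
-- vertices not adjacent to u, u′ in their blocks.  Then B is not a bridge, hence a maximal
-- 2-connected subgraph; so w is not adjacent to u in G either, and w reaches u avoiding any other
-- single vertex.  Distinct blocks through u lie in different components of G − u (a connecting
-- walk would yield an ear of B), so the chain of blocks from u to B′ avoids the component K of
-- G − u containing w.  A cop at or next to w lies in K: it is then not near w′, and when it is
-- adjacent to w the robber runs w ⇝ u ⇝ w′ without meeting it.  Symmetrically for w′, so a
-- robber who waits at w or w′ and switches whenever the cop becomes adjacent is never caught.

module Submission where

open import Defs hiding (sym; irrefl)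
open import Data.Nat using (ℕ; zero; suc)
open import Data.Fin using (Fin; zero; suc; _≟_; inject₁; fromℕ; opposite)
open import Data.Fin.Properties using (fromℕ≢inject₁; opposite-involutive; sequence)
open import Data.Fin.Induction using (<-weakInduction)
open import Data.Bool using (Bool; true; false; not)
open import Data.Bool.Properties using (⇔→≡) renaming (_≟_ to _≟ᵇ_)
open import Data.List using (List; []; _∷_)
open import Data.List.Membership.Propositional using (_∈_)
import Data.List.Membership.DecPropositional as DecMembership
open import Data.List.Relation.Unary.Any using (here; there)
open import Data.List.Relation.Unary.All using ([]; lookup)
open import Data.List.Relation.Unary.All.Properties using (¬Any⇒All¬)
open import Data.List.Relation.Unary.Unique.Propositional using (Unique; []; _∷_)
open import Data.Product using (Σ-syntax; ∃-syntax; _×_; _,_; proj₁; proj₂; map₁)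
open import Data.Sum using (_⊎_; inj₁; inj₂)
open import Data.Unit using (⊤; tt)
open import Data.Empty using (⊥; ⊥-elim)
open import Effect.Monad using (RawMonad)
open import Function using (id; _∘_)
open import Function.Bundles using (_⇔_; Equivalence; mk⇔)
open import Relation.Nullary using (¬_; Dec; yes; no; does)
open import Relation.Nullary.Decidable
  using (_×-dec_; _⊎-dec_; dec-true; does-⇔; ¬¬-excluded-middle)
open import Relation.Nullary.Negation using (¬¬-Monad)
open import Relation.Unary using (Decidable)
import Relation.Binary.Definitions as B
open import Relation.Binary.PropositionalEquality
  using (_≡_; _≢_; refl; sym; cong; subst; ≢-sym; module ≡-Reasoning)

dec-true⁻¹ : ∀ {A : Set} (a? : Dec A) → does a? ≡ true → A
dec-true⁻¹ (yes a) _ = a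
dec-true⁻¹ (no _) ()

opposite-inject₁ : ∀ {k} (i : Fin (suc k)) → opposite (inject₁ i) ≡ suc (opposite i)
opposite-inject₁ zero           = refl
opposite-inject₁ {suc k} (suc i) = cong inject₁ (opposite-inject₁ i)

opposite-fromℕ : ∀ k → opposite (fromℕ k) ≡ zero
opposite-fromℕ zero    = refl
opposite-fromℕ (suc k) = cong inject₁ (opposite-fromℕ k)

opposite-injective : ∀ {k} {i j : Fin k} → opposite i ≡ opposite j → i ≡ j
opposite-injective {i = i} {j} eq = begin
  i                     ≡⟨ opposite-involutive i ⟨
  opposite (opposite i) ≡⟨ cong opposite eq ⟩
  opposite (opposite j) ≡⟨ opposite-involutive j ⟩
  j                     ∎
  where open ≡-Reasoning

module _ {n : ℕ} {E : Fin n → Fin n → Set} {ok : Fin n → Set} where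

  open DecMembership (_≟_ {n}) using (_∈?_)

  head-ok : ∀ {u v} → Walk E ok u v → ok u
  head-ok (here o)     = o
  head-ok (step o _ _) = o

  last-ok : ∀ {u v} → Walk E ok u v → ok v
  last-ok (here o)     = o
  last-ok (step _ _ W) = last-ok W

  infixr 5 _++_
  _++_ : ∀ {u v w} → Walk E ok u v → Walk E ok v w → Walk E ok u w
  here _     ++ W′ = W′
  step o e W ++ W′ = step o e (W ++ W′)

  reverse : (∀ {a b} → E a b → E b a) → ∀ {u v} → Walk E ok u v → Walk E ok v u
  reverse E-sym (here o)     = here o
  reverse E-sym (step o e W) = reverse E-sym W ++ step (head-ok W) (E-sym e) (here o)

  vertices : ∀ {u v} → Walk E ok u v → List (Fin n)
  vertices (here {u} _)     = u ∷ []
  vertices (step {u} _ _ W) = u ∷ vertices W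

  head∈vertices : ∀ {u v} (W : Walk E ok u v) → u ∈ vertices W
  head∈vertices (here _)     = here refl
  head∈vertices (step _ _ _) = here refl

  restrict : ∀ {P : Fin n → Set} {u v} (W : Walk E ok u v) →
             (∀ {y} → y ∈ vertices W → P y) → Walk E P u v
  restrict (here _)     P-W = here (P-W (here refl))
  restrict (step _ e W) P-W = step (P-W (here refl)) e (restrict W (λ y∈W → P-W (there y∈W)))

  dropUntil : ∀ {u v x} (W : Walk E ok u v) → x ∈ vertices W → Walk E ok x v
  dropUntil (here o)     (here refl) = here o
  dropUntil (step o e W) (here refl) = step o e W
  dropUntil (step _ _ W) (there x∈W) = dropUntil W x∈W

  dropUntil-⊆ : ∀ {u v x y} (W : Walk E ok u v) (x∈W : x ∈ vertices W) →
                y ∈ vertices (dropUntil W x∈W) → y ∈ vertices W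
  dropUntil-⊆ (here _)     (here refl) y∈ = y∈
  dropUntil-⊆ (step _ _ _) (here refl) y∈ = y∈
  dropUntil-⊆ (step _ _ W) (there x∈W) y∈ = there (dropUntil-⊆ W x∈W y∈)

  dropUntil-unique : ∀ {u v x} (W : Walk E ok u v) (x∈W : x ∈ vertices W) →
                     Unique (vertices W) → Unique (vertices (dropUntil W x∈W))
  dropUntil-unique (here _)     (here refl) U       = U
  dropUntil-unique (step _ _ _) (here refl) U       = U
  dropUntil-unique (step _ _ W) (there x∈W) (_ ∷ U) = dropUntil-unique W x∈W U

  toPath : ∀ {u v} → Walk E ok u v → Σ[ P ∈ Walk E ok u v ] Unique (vertices P)
  toPath (here o) = here o , [] ∷ []
  toPath (step {u} o e W) with toPath W
  ... | P , U with u ∈? vertices P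
  ...   | yes u∈P = dropUntil P u∈P , dropUntil-unique P u∈P U
  ...   | no  u∉P = step o e P , ¬Any⇒All¬ _ u∉P ∷ U

module _ {n : ℕ} {E : Fin n → Fin n → Set} where

  map : ∀ {E′ : Fin n → Fin n → Set} {ok ok′ : Fin n → Set} →
        (∀ {a b} → ok a → ok b → E a b → E′ a b) → (∀ {a} → ok a → ok′ a) →
        ∀ {u v} → Walk E ok u v → Walk E′ ok′ u v
  map f g (here o)     = here (g o)
  map f g (step o e W) = step (g o) (f o (head-ok W) e) (map f g W)

  weaken : ∀ {ok ok′ : Fin n → Set} → (∀ {a} → ok a → ok′ a) →
           ∀ {u v} → Walk E ok u v → Walk E ok′ u v
  weaken = map (λ _ _ e → e)

  vertices-map : ∀ {E′ : Fin n → Fin n → Set} {ok ok′ : Fin n → Set}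
                 (f : ∀ {a b} → ok a → ok b → E a b → E′ a b) (g : ∀ {a} → ok a → ok′ a) →
                 ∀ {u v} (W : Walk E ok u v) →
                 vertices (map {E′ = E′} {ok′ = ok′} f g W) ≡ vertices W
  vertices-map f g (here _)         = refl
  vertices-map f g (step {u} _ _ W) = cong (u ∷_) (vertices-map f g W)

  reachesEndAvoiding : ∀ {ok : Fin n → Set} {a b p} x (Q : Walk E ok a b) → Unique (vertices Q) →
    p ∈ vertices Q → p ≢ x →
    Walk E (λ y → y ∈ vertices Q × y ≢ x) a p ⊎ Walk E (λ y → y ∈ vertices Q × y ≢ x) p b
  reachesEndAvoiding x (here _)     _ (here refl) p≢x = inj₁ (here (here refl , p≢x))
  reachesEndAvoiding x (step _ _ _) _ (here refl) p≢x = inj₁ (here (here refl , p≢x))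
  reachesEndAvoiding {a = a} x (step _ e Q) (a∉Q ∷ U) (there p∈Q) p≢x
    with reachesEndAvoiding x Q U p∈Q p≢x
  ... | inj₂ W = inj₂ (weaken (λ (y∈Q , y≢x) → there y∈Q , y≢x) W)
  ... | inj₁ W with a ≟ x
  ...   | no  a≢x = inj₁ (step (here refl , a≢x) e (weaken (λ (y∈Q , y≢x) → there y∈Q , y≢x) W))
  ...   | yes refl = inj₂ (restrict (dropUntil Q p∈Q) λ y∈ →
            let y∈Q = dropUntil-⊆ Q p∈Q y∈ in there y∈Q , ≢-sym (lookup a∉Q y∈Q))

module _ {n : ℕ} {E : Fin n → Fin n → Set} {ok P : Fin n → Set} (P? : Decidable P) where

  record ExitTo (t : Fin n) : Set where
    field
      from to : Fin n
      from∈P  : P from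
      from-ok : ok from
      edge    : E from to
      outside : Walk E (λ v → ¬ P v) to t

  lastExitOrOutside : ∀ {s t} → Walk E ok s t → ¬ P t → ExitTo t ⊎ Walk E (λ v → ¬ P v) s t
  lastExitOrOutside (here _) ¬Pt = inj₂ (here ¬Pt)
  lastExitOrOutside {s} (step o e W) ¬Pt with lastExitOrOutside W ¬Pt
  ... | inj₁ exit = inj₁ exit
  ... | inj₂ W′ with P? s
  ...   | yes Ps = inj₁ (record { from∈P = Ps ; from-ok = o ; edge = e ; outside = W′ })
  ...   | no ¬Ps = inj₂ (step ¬Ps e W′)

  lastExit : ∀ {s t} → Walk E ok s t → P s → ¬ P t → ExitTo t
  lastExit W Ps ¬Pt with lastExitOrOutside W ¬Pt
  ... | inj₁ exit = exit
  ... | inj₂ W′ = ⊥-elim (head-ok W′ Ps)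

module _ {n : ℕ} (G : SimpleGraph n) where

  private
    Adj-sym : ∀ {u v} → Adj G u v → Adj G v u
    Adj-sym = SimpleGraph.sym G

  AtLeastThree : (Fin n → Set) → Set
  AtLeastThree P = ∃[ a ] ∃[ b ] ∃[ c ] (P a × P b × P c × a ≢ b × b ≢ c × a ≢ c)

  TwoConnectedSet : (Fin n → Set) → Set
  TwoConnectedSet P = AtLeastThree P
    × (∀ x u v → P u → P v → u ≢ x → v ≢ x → Walk (Adj G) (λ w → P w × w ≢ x) u v)

  atLeastThree-map : ∀ {P Q : Fin n → Set} → (∀ {v} → P v → Q v) → AtLeastThree P → AtLeastThree Q
  atLeastThree-map f (a , b , c , Pa , Pb , Pc , distinct) =
    a , b , c , f Pa , f Pb , f Pc , distinct

  atLeastThree-avoid : ∀ {P} → AtLeastThree P → ∀ x y → ∃[ t ] (P t × t ≢ x × t ≢ y)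
  atLeastThree-avoid (a , b , c , Pa , Pb , Pc , a≢b , b≢c , a≢c) x y
    with a ≟ x | a ≟ y | b ≟ x | b ≟ y
  ... | no a≢x | no a≢y | _        | _        = a , Pa , a≢x , a≢y
  ... | yes refl | _    | _        | no b≢y   = b , Pb , ≢-sym a≢b , b≢y
  ... | _      | yes refl | no b≢x | _        = b , Pb , b≢x , ≢-sym a≢b
  ... | yes refl | _    | _        | yes refl = c , Pc , ≢-sym a≢c , ≢-sym b≢c
  ... | _      | yes refl | yes refl | _      = c , Pc , ≢-sym b≢c , ≢-sym a≢c

  twoConnectedSet-walk : ∀ {P} → TwoConnectedSet P → ∀ {u v} → P u → P v → Walk (Adj G) P u v
  twoConnectedSet-walk (P3 , connected) {u} {v} Pu Pv with atLeastThree-avoid P3 u v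
  ... | t , _ , t≢u , t≢v = weaken proj₁ (connected t u v Pu Pv (≢-sym t≢u) (≢-sym t≢v))

  ∪-twoConnectedSet : ∀ {P Q a b} → TwoConnectedSet P → TwoConnectedSet Q →
    P a → Q a → P b → Q b → a ≢ b → TwoConnectedSet (λ v → P v ⊎ Q v)
  ∪-twoConnectedSet {P} {Q} {a} {b} (P3 , P-conn) (_ , Q-conn) Pa Qa Pb Qb a≢b =
    atLeastThree-map inj₁ P3 , connected
    where
      hub : ∀ x → ∃[ t ] (P t × Q t × t ≢ x)
      hub x with a ≟ x
      ... | no a≢x  = a , Pa , Qa , a≢x
      ... | yes refl = b , Pb , Qb , ≢-sym a≢b

      connected : ∀ x u v → P u ⊎ Q u → P v ⊎ Q v → u ≢ x → v ≢ x →
                  Walk (Adj G) (λ w → (P w ⊎ Q w) × w ≢ x) u v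
      connected x u v Ru Rv u≢x v≢x with hub x
      ... | t , Pt , Qt , t≢x = toHub Ru u≢x ++ reverse Adj-sym (toHub Rv v≢x)
        where
          toHub : ∀ {p} → P p ⊎ Q p → p ≢ x → Walk (Adj G) (λ w → (P w ⊎ Q w) × w ≢ x) p t
          toHub (inj₁ Pp) p≢x = weaken (map₁ inj₁) (P-conn x _ t Pp Pt p≢x t≢x)
          toHub (inj₂ Qp) p≢x = weaken (map₁ inj₂) (Q-conn x _ t Qp Qt p≢x t≢x)

  ear-twoConnectedSet : ∀ {P ok a b} → TwoConnectedSet P → (Q : Walk (Adj G) ok a b) →
    Unique (vertices Q) → P a → P b → TwoConnectedSet (λ v → P v ⊎ v ∈ vertices Q)
  ear-twoConnectedSet {P} (P3 , P-conn) Q Q-unique Pa Pb =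
    atLeastThree-map inj₁ P3 , connected
    where
      R : Fin n → Set
      R v = P v ⊎ v ∈ vertices Q

      connected : ∀ x u v → R u → R v → u ≢ x → v ≢ x → Walk (Adj G) (λ w → R w × w ≢ x) u v
      connected x u v Ru Rv u≢x v≢x with atLeastThree-avoid P3 x x
      ... | t , Pt , t≢x , _ = toHub Ru u≢x ++ reverse Adj-sym (toHub Rv v≢x)
        where
          viaP : ∀ {p} → P p → p ≢ x → Walk (Adj G) (λ w → R w × w ≢ x) p t
          viaP Pp p≢x = weaken (map₁ inj₁) (P-conn x _ t Pp Pt p≢x t≢x)

          toHub : ∀ {p} → R p → p ≢ x → Walk (Adj G) (λ w → R w × w ≢ x) p t
          toHub (inj₁ Pp) p≢x = viaP Pp p≢x
          toHub (inj₂ p∈Q) p≢x with reachesEndAvoiding x Q Q-unique p∈Q p≢x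
          ... | inj₁ W = weaken (map₁ inj₂) (reverse Adj-sym W) ++ viaP Pa (proj₂ (head-ok W))
          ... | inj₂ W = weaken (map₁ inj₂) W ++ viaP Pb (proj₂ (last-ok W))

  twoConnected→set : ∀ (H : Subgraph G) → TwoConnected H → TwoConnectedSet (InV H)
  twoConnected→set H (H3 , _ , connected) = H3 , λ x u v Hu Hv u≢x v≢x →
    map (λ _ _ → edgAdj H) id (connected x u v Hu Hv u≢x v≢x)

module _ {n : ℕ} {G : SimpleGraph n} where

  ⊆G-trans : ∀ {H₁ H₂ H₃ : Subgraph G} → H₁ ⊆G H₂ → H₂ ⊆G H₃ → H₁ ⊆G H₃
  ⊆G-trans (V₁₂ , E₁₂) (V₂₃ , E₂₃) = (λ v p → V₂₃ v (V₁₂ v p)) , (λ u v e → E₂₃ u v (E₁₂ u v e))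

  ⊆G-antisym : ∀ {H H′ : Subgraph G} → H ⊆G H′ → H′ ⊆G H → SameSub H H′
  ⊆G-antisym (V , E) (V′ , E′) =
    (λ v → ⇔→≡ (mk⇔ (V v) (V′ v))) , (λ u v → ⇔→≡ (mk⇔ (E u v) (E′ u v)))

  InV? : (H : Subgraph G) → Decidable (InV H)
  InV? H v = vtx H v ≟ᵇ true

  subgraphWalk : ∀ (H : Subgraph G) {ok u v} → Walk (InE H) ok u v → Walk (Adj G) ok u v
  subgraphWalk H = map (λ _ _ → edgAdj H) id

module Induced {n : ℕ} (G : SimpleGraph n) (adj? : B.Decidable (Adj G))
               {P : Fin n → Set} (P? : Decidable P) where

  inducedEdge? : ∀ u v → Dec (P u × P v × Adj G u v)
  inducedEdge? u v = P? u ×-dec P? v ×-dec adj? u v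

  induced : Subgraph G
  induced = record
    { vtx    = λ v → does (P? v)
    ; edg    = λ u v → does (inducedEdge? u v)
    ; edgAdj = λ {u} {v} e → proj₂ (proj₂ (dec-true⁻¹ (inducedEdge? u v) e))
    ; edgL   = λ {u} {v} e → dec-true (P? u) (proj₁ (dec-true⁻¹ (inducedEdge? u v) e))
    ; edgR   = λ {u} {v} e → dec-true (P? v) (proj₁ (proj₂ (dec-true⁻¹ (inducedEdge? u v) e)))
    ; edgSym = λ u v → does-⇔ (mk⇔ swap swap) (inducedEdge? u v) (inducedEdge? v u)
    }
    where
      swap : ∀ {u v} → P u × P v × Adj G u v → P v × P u × Adj G v u
      swap (Pu , Pv , e) = Pv , Pu , SimpleGraph.sym G e

  induced-edge : ∀ {u v} → P u → P v → Adj G u v → InE induced u v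
  induced-edge Pu Pv e = dec-true (inducedEdge? _ _) (Pu , Pv , e)

  ⊆-induced : ∀ H → (∀ v → InV H v → P v) → H ⊆G induced
  ⊆-induced H H⊆P =
    (λ v Hv → dec-true (P? v) (H⊆P v Hv)) ,
    (λ u v e → induced-edge (H⊆P u (edgL H e)) (H⊆P v (edgR H e)) (edgAdj H e))

  twoConnectedSet→induced : TwoConnectedSet G P → TwoConnected induced
  twoConnectedSet→induced P-2c@(P3 , connected) =
    atLeastThree-map G toInduced P3 ,
    (λ u v Iu Iv → inInduced id (weaken toInduced
                     (twoConnectedSet-walk G P-2c (fromInduced Iu) (fromInduced Iv)))) ,
    (λ x u v Iu Iv u≢x v≢x → inInduced proj₁ (weaken (map₁ toInduced)
                     (connected x u v (fromInduced Iu) (fromInduced Iv) u≢x v≢x)))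
    where
      toInduced : ∀ {v} → P v → InV induced v
      toInduced = dec-true (P? _)

      fromInduced : ∀ {v} → InV induced v → P v
      fromInduced = dec-true⁻¹ (P? _)

      inInduced : ∀ {ok u v} → (∀ {w} → ok w → InV induced w) →
                  Walk (Adj G) ok u v → Walk (InE induced) ok u v
      inInduced okI = map (λ oa ob → induced-edge (fromInduced (okI oa)) (fromInduced (okI ob))) id

module Blocks {n : ℕ} (G : SimpleGraph n) (adj? : B.Decidable (Adj G)) where

  open Induced G adj? using (induced; induced-edge; ⊆-induced; twoConnectedSet→induced)
  open DecMembership (_≟_ {n}) using (_∈?_)

  private
    Adj-sym : ∀ {u v} → Adj G u v → Adj G v u
    Adj-sym = SimpleGraph.sym G

  MaximalTwoConnected : Subgraph G → Set
  MaximalTwoConnected B = TwoConnected B × (∀ (H : Subgraph G) → TwoConnected H → B ⊆G H → H ⊆G B)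

  Bridge : Subgraph G → Set
  Bridge B = ∃[ u ] ∃[ v ] (Adj G u v
    × (∀ w → InV B w ⇔ (w ≡ u ⊎ w ≡ v))
    × (∀ a b → InE B a b ⇔ ((a ≡ u × b ≡ v) ⊎ (a ≡ v × b ≡ u)))
    × (∀ (H : Subgraph G) → TwoConnected H → ¬ InE H u v))

  maximal-⊇induced : ∀ B {P} (P? : Decidable P) → MaximalTwoConnected B → TwoConnectedSet G P →
                     (∀ v → InV B v → P v) → induced P? ⊆G B
  maximal-⊇induced B P? (_ , maximal) P-2c B⊆P =
    maximal (induced P?) (twoConnectedSet→induced P? P-2c) (⊆-induced P? B B⊆P)

  maximal-induced : ∀ B {u v} → MaximalTwoConnected B → InV B u → InV B v → Adj G u v → InE B u v
  maximal-induced B max@(B-2c , _) Bu Bv e =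
    proj₂ (maximal-⊇induced B (InV? B) max (twoConnected→set G B B-2c) (λ _ → id)) _ _
          (induced-edge (InV? B) Bu Bv e)

  bridge-edge : ∀ B {a b} → Bridge B → InV B a → InV B b → a ≢ b → InE B a b
  bridge-edge B {a} {b} (_ , _ , _ , vtx⇔ , edg⇔ , _) Ba Bb a≢b
    with Equivalence.to (vtx⇔ a) Ba | Equivalence.to (vtx⇔ b) Bb
  ... | inj₁ refl | inj₁ refl = ⊥-elim (a≢b refl)
  ... | inj₂ refl | inj₂ refl = ⊥-elim (a≢b refl)
  ... | inj₁ refl | inj₂ refl = Equivalence.from (edg⇔ a b) (inj₁ (refl , refl))
  ... | inj₂ refl | inj₁ refl = Equivalence.from (edg⇔ a b) (inj₂ (refl , refl))

  block-walk : ∀ B {a b} → IsBlock B → InV B a → InV B b → Walk (Adj G) (InV B) a b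
  block-walk B (inj₁ ((_ , connected , _) , _)) Ba Bb = subgraphWalk B (connected _ _ Ba Bb)
  block-walk B {a} {b} (inj₂ bridge) Ba Bb with a ≟ b
  ... | yes refl = here Ba
  ... | no a≢b  = step Ba (edgAdj B (bridge-edge B bridge Ba Bb a≢b)) (here Bb)

  block-walk-avoiding : ∀ B {a b} → IsBlock B → ∀ x → InV B a → InV B b → a ≢ x → b ≢ x →
                        Walk (Adj G) (_≢ x) a b
  block-walk-avoiding B (inj₁ ((_ , _ , connected) , _)) x Ba Bb a≢x b≢x =
    weaken proj₂ (subgraphWalk B (connected x _ _ Ba Bb a≢x b≢x))
  block-walk-avoiding B {a} {b} (inj₂ bridge) x Ba Bb a≢x b≢x with a ≟ b
  ... | yes refl = here a≢x
  ... | no a≢b  = step a≢x (edgAdj B (bridge-edge B bridge Ba Bb a≢b)) (here b≢x)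

  nonedge-maximal : ∀ B {u w} → IsBlock B → InV B u → InV B w → w ≢ u → ¬ InE B u w →
                    MaximalTwoConnected B
  nonedge-maximal B (inj₁ max)    _  _  _   _   = max
  nonedge-maximal B (inj₂ bridge) Bu Bw w≢u ¬uw =
    ⊥-elim (¬uw (bridge-edge B bridge Bu Bw (≢-sym w≢u)))

  blocks-meet-once : ∀ B₀ B₁ {u x} → MaximalTwoConnected B₀ → IsBlock B₁ → ¬ SameSub B₀ B₁ →
    InV B₀ u → InV B₁ u → InV B₀ x → InV B₁ x → x ≡ u
  blocks-meet-once B₀ B₁ {u} {x} max₀ B₁-block B₀≠B₁ B₀u B₁u B₀x B₁x with x ≟ u
  ... | yes x≡u = x≡u
  ... | no x≢u = ⊥-elim (distinct B₁-block)
    where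
      unshared-edge : Bridge B₁ → InE B₁ u x → ⊥
      unshared-edge (_ , _ , _ , _ , edg⇔ , unshared) ux∈B₁ with Equivalence.to (edg⇔ u x) ux∈B₁
      ... | inj₁ (refl , refl) =
        unshared B₀ (proj₁ max₀) (maximal-induced B₀ max₀ B₀u B₀x (edgAdj B₁ ux∈B₁))
      ... | inj₂ (refl , refl) =
        unshared B₀ (proj₁ max₀) (maximal-induced B₀ max₀ B₀x B₀u (Adj-sym (edgAdj B₁ ux∈B₁)))

      distinct : IsBlock B₁ → ⊥
      distinct (inj₁ max₁) =
        B₀≠B₁ (⊆G-antisym {H = B₀} {B₁} (contains B₁ max₁ B₀ inj₁ inj₂)
                                         (contains B₀ max₀ B₁ inj₂ inj₁))
        where
          union? : Decidable (λ v → InV B₀ v ⊎ InV B₁ v)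
          union? v = InV? B₀ v ⊎-dec InV? B₁ v

          union-2c : TwoConnectedSet G (λ v → InV B₀ v ⊎ InV B₁ v)
          union-2c = ∪-twoConnectedSet G (twoConnected→set G B₀ (proj₁ max₀))
                       (twoConnected→set G B₁ (proj₁ max₁)) B₀u B₁u B₀x B₁x (≢-sym x≢u)

          contains : ∀ B → MaximalTwoConnected B → ∀ (H : Subgraph G) →
                     (∀ {v} → InV H v → InV B₀ v ⊎ InV B₁ v) →
                     (∀ {v} → InV B v → InV B₀ v ⊎ InV B₁ v) → H ⊆G B
          contains B max H H⊆ B⊆ =
            ⊆G-trans {H₁ = H} {induced union?} {B} (⊆-induced union? H (λ _ → H⊆))
                     (maximal-⊇induced B union? max union-2c (λ _ → B⊆))
      distinct (inj₂ bridge) = unshared-edge bridge (bridge-edge B₁ bridge B₁u B₁x (≢-sym x≢u))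

  OutsideEdge : Subgraph G → Fin n → Fin n → Set
  OutsideEdge B u v = Adj G u v × (¬ InV B u ⊎ ¬ InV B v)

  -- Shortening W to a path, its first edge leaves B; B together with that path is again
  -- 2-connected, so maximality pulls the vertex outside B back into B.
  maximal-noEar : ∀ B {ok a b} → MaximalTwoConnected B → InV B a → InV B b → a ≢ b →
                  ¬ Walk (OutsideEdge B) ok a b
  maximal-noEar B max Ba Bb a≢b W with toPath W
  ... | here _ , _ = a≢b refl
  ... | step _ (_ , inj₁ ¬Ba) _ , _ = ¬Ba Ba
  ... | step {w = z} o (e , inj₂ ¬Bz) Q , Q-unique =
    ¬Bz (proj₁ (maximal-⊇induced B R? max R-2c (λ _ → inj₁)) z (dec-true (R? z) (inj₂ z∈P)))
    where
      P = map (λ _ _ → proj₁) id (step o (e , inj₂ ¬Bz) Q)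
      vertices-P = vertices-map (λ _ _ → proj₁) id (step o (e , inj₂ ¬Bz) Q)

      R? : Decidable (λ v → InV B v ⊎ v ∈ vertices P)
      R? v = InV? B v ⊎-dec (v ∈? vertices P)

      R-2c : TwoConnectedSet G (λ v → InV B v ⊎ v ∈ vertices P)
      R-2c = ear-twoConnectedSet G (twoConnected→set G B (proj₁ max)) P
               (subst Unique (sym vertices-P) Q-unique) Ba Bb

      z∈P : z ∈ vertices P
      z∈P = subst (z ∈_) (sym vertices-P) (there (head∈vertices Q))

  -- A walk from B₀ to B₁ avoiding u would close, together with a walk inside B₁, an ear of B₀.
  blocks-separated : ∀ B₀ B₁ {u s y} → MaximalTwoConnected B₀ → IsBlock B₁ → ¬ SameSub B₀ B₁ →
    InV B₀ u → InV B₁ u → InV B₀ s → InV B₁ y → ¬ Walk (Adj G) (_≢ u) s y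
  blocks-separated B₀ B₁ {u} {y = y} max₀ B₁-block B₀≠B₁ B₀u B₁u B₀s B₁y W =
    maximal-noEar B₀ max₀ exit.from∈P B₀u exit.from-ok ear
    where
      meet : ∀ {x} → InV B₀ x → InV B₁ x → x ≡ u
      meet = blocks-meet-once B₀ B₁ max₀ B₁-block B₀≠B₁ B₀u B₁u

      ¬B₀y : ¬ InV B₀ y
      ¬B₀y B₀y = last-ok W (meet B₀y B₁y)

      module exit  = ExitTo (lastExit (InV? B₀) W B₀s ¬B₀y)
      module entry = ExitTo (lastExit (InV? B₀) (reverse Adj-sym (block-walk B₁ B₁-block B₁y B₁u))
                                      B₀u ¬B₀y)

      outside : ∀ {c d} → Walk (Adj G) (λ v → ¬ InV B₀ v) c d → Walk (OutsideEdge B₀) (λ _ → ⊤) c d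
      outside = map (λ ¬B₀c _ e → e , inj₁ ¬B₀c) _

      ear : Walk (OutsideEdge B₀) (λ _ → ⊤) exit.from u
      ear = subst (Walk (OutsideEdge B₀) (λ _ → ⊤) exit.from) (meet entry.from∈P entry.from-ok)
        (step tt (exit.edge , inj₂ (head-ok exit.outside))
          (outside exit.outside
           ++ outside (reverse Adj-sym entry.outside)
           ++ step tt (Adj-sym entry.edge , inj₁ (head-ok entry.outside)) (here tt)))

module Pursuit {n : ℕ} (G : SimpleGraph n) where

  private
    Adj-sym : ∀ {u v} → Adj G u v → Adj G v u
    Adj-sym = SimpleGraph.sym G

  Near : Fin n → Fin n → Set
  Near c r = c ≡ r ⊎ Adj G c r

  Behind : Fin n → Fin n → Fin n → Set
  Behind w U = Walk (Adj G) (_≢ U) w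

  record Facing (w U w′ : Fin n) : Set where
    field
      home≢gate : w ≢ U
      gate≁home : ¬ Adj G U w
      around    : ∀ c → c ≢ w → c ≢ U → Walk (Adj G) (_≢ c) w U
      toFar     : Walk (Adj G) (λ v → ¬ Behind w U v) U w′
      far≢gate  : w′ ≢ U

    near⇒behind : ∀ {c} → Near c w → Behind w U c
    near⇒behind (inj₁ refl) = here home≢gate
    near⇒behind (inj₂ c~w)  = step home≢gate (Adj-sym c~w) (here λ { refl → gate≁home c~w })

    escape : ∀ {c} → Adj G c w → Walk (Adj G) (_≢ c) w w′
    escape {c} c~w =
      around c (λ { refl → SimpleGraph.irrefl G c~w }) (λ { refl → gate≁home c~w })
      ++ weaken (λ { ¬behind refl → ¬behind (near⇒behind (inj₂ c~w)) }) toFar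

    separated : ∀ {c} → Near c w → ¬ Near c w′
    separated near (inj₁ refl)  = last-ok toFar (near⇒behind near)
    separated near (inj₂ c~w′) =
      last-ok toFar (near⇒behind near ++ step (last-ok (near⇒behind near)) c~w′ (here far≢gate))

  module Evasion (adj? : B.Decidable (Adj G)) (home : Bool → Fin n)
                 (facing : ∀ b → ∃[ U ] Facing (home b) U (home (not b))) where

    open Game G 1

    private
      module F b = Facing (proj₂ (facing b))

    near? : ∀ c r → Dec (Near c r)
    near? c r = (c ≟ r) ⊎-dec adj? c r

    hide : Fin n → Bool
    hide c with near? c (home false)
    ... | yes _ = true
    ... | no  _ = false

    hide-safe : ∀ c → ¬ Near c (home (hide c))
    hide-safe c with near? c (home false)
    ... | yes near = F.separated false near
    ... | no ¬near = ¬near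

    flee : Fin n → Bool → Bool
    flee c b with adj? c (home b)
    ... | yes _ = not b
    ... | no  _ = b

    copMove-misses : ∀ {c c′} b → ¬ Near c (home b) → c′ ≡ c ⊎ Adj G c c′ → c′ ≢ home b
    copMove-misses b ¬near (inj₁ refl) refl = ¬near (inj₁ refl)
    copMove-misses b ¬near (inj₂ c~c′) refl = ¬near (inj₂ c~c′)

    flee-safe : ∀ {c} b → c ≢ home b →
      ¬ Near c (home (flee c b)) × Walk (Adj G) (_≢ c) (home b) (home (flee c b))
    flee-safe {c} b c≢h with adj? c (home b)
    ... | yes c~h = F.separated b (inj₂ c~h) , F.escape b c~h
    ... | no ¬c~h = (λ { (inj₁ c≡h) → c≢h c≡h ; (inj₂ c~h) → ¬c~h c~h }) , here (≢-sym c≢h)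

    record Round : Set where
      field
        cops : Config
        side : Bool
        past : History

    robberEvades : ¬ CopsWin
    robberEvades (σ , legal , wins) = uncaught (wins copsAt robberAt consistent robberLegal)
      where
        round : ℕ → Round
        round zero    = record { cops = start σ ; side = hide (start σ zero) ; past = [] }
        round (suc t) = record { cops = c ; side = flee (c zero) (Round.side r) ; past = h }
          where
            r = round t
            h = (Round.cops r , home (Round.side r)) ∷ Round.past r
            c = next σ h

        copsAt : ℕ → Config
        copsAt t = Round.cops (round t)

        robberAt : ℕ → Fin n
        robberAt t = home (Round.side (round t))

        history : ∀ t → hist copsAt robberAt t ≡ (copsAt t , robberAt t) ∷ Round.past (round t)
        history zero    = refl
        history (suc t) = cong ((copsAt (suc t) , robberAt (suc t)) ∷_) (history t)

        consistent : Consistent σ copsAt robberAt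
        consistent = refl , λ t → cong (next σ) (sym (history t))

        misses : ∀ t → copsAt (suc t) zero ≢ robberAt t
        safe   : ∀ t → ¬ Near (copsAt t zero) (robberAt t)

        misses t = copMove-misses (Round.side (round t)) (safe t)
                     (legal (copsAt t) (robberAt t) (Round.past (round t)) zero)

        safe zero    = hide-safe (start σ zero)
        safe (suc t) = proj₁ (flee-safe (Round.side (round t)) (misses t))

        robberLegal : RobberLegal copsAt robberAt
        robberLegal t = weaken (λ v≢c → λ { zero → ≢-sym v≢c })
                          (proj₂ (flee-safe (Round.side (round t)) (misses t)))

        uncaught : ¬ Captured copsAt robberAt
        uncaught (t , zero , inj₁ c≡r)  = safe t (inj₁ c≡r)
        uncaught (t , zero , inj₂ c′≡r) = misses t c′≡r

module Hallways {n : ℕ} (G : SimpleGraph n) (adj? : B.Decidable (Adj G)) where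

  open Blocks G adj?
  open Pursuit G

  -- A hallway seen from one of its directed holes: (block zero , cut zero), witnessed by home.
  record HoleChain : Set where
    field
      m                 : ℕ
      block             : Fin (suc (suc m)) → Subgraph G
      cut               : Fin (suc m) → Fin n
      isBlock           : ∀ i → IsBlock (block i)
      cut∈left          : ∀ i → InV (block (inject₁ i)) (cut i)
      cut∈right         : ∀ i → InV (block (suc i)) (cut i)
      block₀≢block₁     : ¬ SameSub (block zero) (block (suc zero))
      cut≢cut₀          : ∀ i → i ≢ zero → cut i ≢ cut zero
      home              : Fin n
      home∈block₀       : InV (block zero) home
      home≢cut₀         : home ≢ cut zero
      cut₀-home-nonedge : ¬ InE (block zero) (cut zero) home

    far : Subgraph G
    far = block (fromℕ (suc m))

  module _ (C : HoleChain) where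

    open HoleChain C
    private
      U = cut zero
      B₁ = block (suc zero)

    block₀-maximal : MaximalTwoConnected (block zero)
    block₀-maximal = nonedge-maximal (block zero) (isBlock zero) (cut∈left zero) home∈block₀
                       home≢cut₀ cut₀-home-nonedge

    Beyond : Fin n → Set
    Beyond v = v ≡ U ⊎ ∃[ y ] (InV B₁ y × Walk (Adj G) (_≢ U) v y)

    beyond-notBehind : ∀ {v} → Beyond v → ¬ Behind home U v
    beyond-notBehind (inj₁ refl) behind = last-ok behind refl
    beyond-notBehind (inj₂ (y , B₁y , v⇝y)) behind =
      blocks-separated (block zero) B₁ block₀-maximal (isBlock (suc zero)) block₀≢block₁
        (cut∈left zero) (cut∈right zero) home∈block₀ B₁y (behind ++ v⇝y)

    block₁-beyond : ∀ {v} → InV B₁ v → Beyond v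
    block₁-beyond {v} B₁v with v ≟ U
    ... | yes v≡U = inj₁ v≡U
    ... | no  v≢U = inj₂ (v , B₁v , here v≢U)

    beyond-block : ∀ B {c v} → IsBlock B → InV B c → c ≢ U → Beyond c → InV B v → Beyond v
    beyond-block B B-block Bc c≢U (inj₁ c≡U) _ = ⊥-elim (c≢U c≡U)
    beyond-block B {v = v} B-block Bc c≢U (inj₂ (y , B₁y , c⇝y)) Bv with v ≟ U
    ... | yes v≡U = inj₁ v≡U
    ... | no  v≢U = inj₂ (y , B₁y , block-walk-avoiding B B-block U Bv Bc v≢U c≢U ++ c⇝y)

    reach : ∀ i {z} → InV (block (suc i)) z → Walk (Adj G) Beyond U z
    reach = <-weakInduction Reach base next
      where
        Reach : Fin (suc m) → Set
        Reach i = ∀ {z} → InV (block (suc i)) z → Walk (Adj G) Beyond U z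

        base : Reach zero
        base B₁z = weaken block₁-beyond (block-walk B₁ (isBlock (suc zero)) (cut∈right zero) B₁z)

        next : ∀ i → Reach (inject₁ i) → Reach (suc i)
        next i reach-i Bz =
          U⇝c ++ weaken (beyond-block B B-block (cut∈right (suc i)) c≢U (last-ok U⇝c))
                        (block-walk B B-block (cut∈right (suc i)) Bz)
          where
            B = block (suc (suc i))
            B-block = isBlock (suc (suc i))
            U⇝c = reach-i (cut∈left (suc i))
            c≢U = cut≢cut₀ (suc i) (λ ())

    far-notBehind : ∀ {v} → InV far v → ¬ Behind home U v
    far-notBehind far-v = beyond-notBehind (last-ok (reach (fromℕ m) far-v))

    facing : ∀ {w′} → InV far w′ → w′ ≢ U → Facing home U w′
    facing far-w′ w′≢U = record
      { home≢gate = home≢cut₀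
      ; gate≁home = λ e → cut₀-home-nonedge
                      (maximal-induced (block zero) block₀-maximal (cut∈left zero) home∈block₀ e)
      ; around    = λ c c≢w c≢U → block-walk-avoiding (block zero) (isBlock zero) c
                      home∈block₀ (cut∈left zero) (≢-sym c≢w) (≢-sym c≢U)
      ; toFar     = weaken beyond-notBehind (reach (fromℕ m) far-w′)
      ; far≢gate  = w′≢U
      }

  open HoleChain using (home; cut; far; home∈block₀; home≢cut₀)

  facing-each-other : ∀ C C′ → InV (far C) (home C′) → InV (far C′) (cut C zero) →
                      Facing (home C) (cut C zero) (home C′)
  facing-each-other C C′ far-w′ far′-U = facing C far-w′ λ w′≡U →
    far-notBehind C′ far′-U (subst (Behind (home C′) (cut C′ zero)) w′≡U (here (home≢cut₀ C′)))

  forwardChain : HasHallway {n} {G} → HoleChain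
  forwardChain (m , Bs , us , blocks , _ , cut∈ , Bs-distinct , us-distinct ,
                (_ , _ , _ , w , Bw , w≢u , ¬uw) , _) = record
    { m = m ; block = Bs ; cut = us ; isBlock = blocks
    ; cut∈left = proj₁ ∘ cut∈ ; cut∈right = proj₂ ∘ cut∈
    ; block₀≢block₁ = Bs-distinct zero (suc zero) (λ ())
    ; cut≢cut₀ = λ i i≢0 → us-distinct i zero i≢0
    ; home = w ; home∈block₀ = Bw ; home≢cut₀ = w≢u ; cut₀-home-nonedge = ¬uw
    }

  backwardChain : HasHallway {n} {G} → HoleChain
  backwardChain (m , Bs , us , blocks , _ , cut∈ , Bs-distinct , us-distinct ,
                 _ , (_ , _ , _ , w , Bw , w≢u , ¬uw)) = record
    { m = m ; block = Bs ∘ opposite ; cut = us ∘ opposite ; isBlock = blocks ∘ opposite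
    ; cut∈left = λ i → subst (λ j → InV (Bs j) (us (opposite i))) (sym (opposite-inject₁ i))
                              (proj₂ (cut∈ (opposite i)))
    ; cut∈right = proj₁ ∘ cut∈ ∘ opposite
    ; block₀≢block₁ = Bs-distinct _ _ fromℕ≢inject₁
    ; cut≢cut₀ = λ i i≢0 → us-distinct _ _ (i≢0 ∘ opposite-injective)
    ; home = w ; home∈block₀ = Bw ; home≢cut₀ = w≢u ; cut₀-home-nonedge = ¬uw
    }

  hallway⇒robberEvades : HasHallway {n} {G} → ¬ Game.CopsWin G 1
  hallway⇒robberEvades hallway@(m , Bs , us , _ , _ , cut∈ , _ , _ ,
                                (_ , _ , _ , _ , Bw , _) , _) =
    Evasion.robberEvades adj? homes faces
    where
      C  = forwardChain hallway
      C′ = backwardChain hallway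

      homes : Bool → Fin n
      homes false = home C
      homes true  = home C′

      in-block₀ : ∀ {v} → InV (Bs zero) v → InV (far C′) v
      in-block₀ = subst (λ j → InV (Bs j) _) (sym (opposite-fromℕ (suc m)))

      faces : ∀ b → ∃[ U ] Facing (homes b) U (homes (not b))
      faces false = _ , facing-each-other C C′ (home∈block₀ C′) (in-block₀ (proj₁ (cut∈ zero)))
      faces true  = _ , facing-each-other C′ C (in-block₀ Bw) (proj₂ (cut∈ (fromℕ m)))

lemma2p4 : (n : ℕ) (G : SimpleGraph n) → Connected G → CInftyIs1 G →
           ¬ HasHallway {n} {G}
lemma2p4 n G _ (oneCopWins , _) hallway =
  adjacency-decidable (λ adj? → Hallways.hallway⇒robberEvades G adj? hallway oneCopWins)
  where
    -- The goal is a negation, so adjacency may be assumed decidable.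
    adjacency-decidable : ¬ ¬ B.Decidable (Adj G)
    adjacency-decidable =
      sequence ¬¬-applicative λ u → sequence ¬¬-applicative λ v → ¬¬-excluded-middle
      where ¬¬-applicative = RawMonad.rawApplicative ¬¬-Monad
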